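{- Let $m,n\ge 1$ be integers. The digraph $\mathit{SB}(m,n)$ has a Hamiltonian cycle if and only if there exists a function $b\colon\Sigma_m^{n-1}\to\{0,1\}$ such that the map $f_b\colon\Sigma_m^n\to\Sigma_m^n$, $f_b(x_1,\dots,x_n)=(x_2,\dots,x_n,\,x_1+b(x_2,\dots,x_n)\bmod m)$, is a single cycle of length $m^n$ in the symmetric group $\operatorname{Sym}(\Sigma_m^n)$.
   Context: $\Sigma_m=\{0,1,\dots,m-1\}$. The digraph $\mathit{SB}(m,n)$ has vertex set $\Sigma_m^n$ and, from each vertex $x_1\dots x_n$, exactly two arcs: the "save" arc $x_1\dots x_n\to x_2\dots x_n x_1$ and the "bump" arc $x_1\dots x_n\to x_2\dots x_n x_1^+$ with $x_1^+=(x_1+1)\bmod m$. The map $f_b$ is a bijection of $\Sigma_m^n$ (its inverse sends $(y_1,\dots,y_n)$ to $(y_n-b(y_1,\dots,y_{n-1}),y_1,\dots,y_{n-1})$), so it lies in $\operatorname{Sym}(\Sigma_m^n)$, the group of all bijections of $\Sigma_m^n$. -}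

module Defs where

open import Data.Nat using (ℕ; zero; suc; _+_; _^_; pred)
open import Data.Nat.DivMod using (_mod_)
open import Data.Fin using (Fin; toℕ)
open import Data.Vec using (Vec; []; _∷_; _∷ʳ_)
open import Data.Product using (Σ; _×_)
open import Data.Sum using (_⊎_)
open import Function.Definitions using (Bijective)
open import Relation.Binary.PropositionalEquality using (_≡_)

Word : ℕ → ℕ → Set
Word m n = Vec (Fin m) n

addMod : ∀ {m} → Fin m → ℕ → Fin m
addMod {suc m} x k = (toℕ x + k) mod (suc m)

inc : ∀ {m} → Fin m → Fin m
inc x = addMod x 1

save : ∀ {m n} → Word m n → Word m n
save [] = []
save (x ∷ xs) = xs ∷ʳ x

bump : ∀ {m n} → Word m n → Word m n
bump [] = []
bump (x ∷ xs) = xs ∷ʳ inc x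

SBArc : ∀ {m n} → Word m n → Word m n → Set
SBArc x y = (y ≡ save x) ⊎ (y ≡ bump x)

next : ∀ {N} → Fin N → Fin N
next {suc N} i = suc (toℕ i) mod suc N

HamiltonianCycle : {V : Set} → (N : ℕ) → (V → V → Set) → Set
HamiltonianCycle {V} N E =
  Σ (Fin N → V) λ c → Bijective _≡_ _≡_ c × (∀ i → E (c i) (c (next i)))

IsSingleCycleOfLength : {V : Set} → (N : ℕ) → (V → V) → Set
IsSingleCycleOfLength {V} N f =
  Σ (Fin N → V) λ c → Bijective _≡_ _≡_ c × (∀ i → f (c i) ≡ c (next i))

fb : ∀ {m n} → (Word m (pred n) → Fin 2) → Word m n → Word m n
fb b [] = []
fb b (x ∷ xs) = xs ∷ʳ addMod x (toℕ (b xs))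

-- A Hamiltonian cycle of SB(m,n) is the same thing as a cyclic permutation σ of Σ_m^n all of
-- whose steps are save or bump arcs. Since save (x⁺ xs) = bump (x xs), injectivity of σ forces:
-- if σ bumps at x xs then it also bumps at x⁺ xs. Going round the residues mod m, for each
-- suffix xs the permutation σ bumps either at every x xs or at none, so σ = f_b where b xs
-- records which. Conversely every step of f_b is a save or a bump arc.
module Submission where

open import Defs
open import Data.Nat using (ℕ; _≤_; _^_; pred)
open import Data.Fin using (Fin)
open import Data.Product using (Σ)
open import Function.Bundles using (_⇔_)

open import Data.Nat using (zero; suc; _+_; _∸_; _%_)
open import Data.Nat.Properties using (+-identityʳ; +-comm; +-assoc; m+[n∸m]≡n; <⇒≤)
open import Data.Nat.DivMod using (_mod_; %-distribˡ-+; m%n%n≡m%n; [m+n]%n≡m%n; m<n⇒m%n≡m)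
open import Data.Fin using (toℕ; zero; suc)
open import Data.Fin.Properties using (toℕ-fromℕ<; toℕ-injective; toℕ<n) renaming (_≟_ to _≟ᶠ_)
open import Data.Vec using (_∷_; []; _∷ʳ_)
open import Data.Vec.Properties using (∷-injectiveˡ; ≡-dec)
open import Data.Product using (_,_; proj₁; proj₂; _×_)
open import Data.Sum using (inj₁; inj₂)
open import Data.Empty using (⊥-elim)
open import Function.Base using (_∘_)
open import Function.Bundles using (mk⇔)
open import Function.Definitions using (Injective; Surjective)
open import Function.Consequences.Propositional using (surjective⇒strictlySurjective)
open import Relation.Nullary using (yes; no)
open import Relation.Binary.PropositionalEquality
  using (_≡_; _≗_; refl; sym; trans; cong; subst; module ≡-Reasoning)
open ≡-Reasoning

module _ {m : ℕ} where

  toℕ-addMod : (x : Fin (suc m)) (k : ℕ) → toℕ (addMod x k) ≡ (toℕ x + k) % suc m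
  toℕ-addMod x k = toℕ-fromℕ< _

  addMod-zero : (x : Fin (suc m)) → addMod x 0 ≡ x
  addMod-zero x = toℕ-injective (begin
    toℕ (addMod x 0)     ≡⟨ toℕ-addMod x 0 ⟩
    (toℕ x + 0) % suc m  ≡⟨ cong (_% suc m) (+-identityʳ (toℕ x)) ⟩
    toℕ x % suc m        ≡⟨ m<n⇒m%n≡m (toℕ<n x) ⟩
    toℕ x                ∎)

  addMod-+ : (x : Fin (suc m)) (k l : ℕ) → addMod (addMod x k) l ≡ addMod x (k + l)
  addMod-+ x k l = toℕ-injective (begin
    toℕ (addMod (addMod x k) l)              ≡⟨ toℕ-addMod (addMod x k) l ⟩
    (toℕ (addMod x k) + l) % suc m           ≡⟨ cong (λ a → (a + l) % suc m) (toℕ-addMod x k) ⟩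
    ((toℕ x + k) % suc m + l) % suc m        ≡⟨ %-distribˡ-+ ((toℕ x + k) % suc m) l (suc m) ⟩
    ((toℕ x + k) % suc m % suc m + l % suc m) % suc m
      ≡⟨ cong (λ a → (a + l % suc m) % suc m) (m%n%n≡m%n (toℕ x + k) (suc m)) ⟩
    ((toℕ x + k) % suc m + l % suc m) % suc m ≡⟨ %-distribˡ-+ (toℕ x + k) l (suc m) ⟨
    (toℕ x + k + l) % suc m                  ≡⟨ cong (_% suc m) (+-assoc (toℕ x) k l) ⟩
    (toℕ x + (k + l)) % suc m                ≡⟨ toℕ-addMod x (k + l) ⟨
    toℕ (addMod x (k + l))                   ∎)

  addMod-suc : (x : Fin (suc m)) (k : ℕ) → addMod x (suc k) ≡ inc (addMod x k)
  addMod-suc x k = trans (cong (addMod x) (+-comm 1 k)) (sym (addMod-+ x k 1))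

  addMod-modulus : (x : Fin (suc m)) → addMod x (suc m) ≡ x
  addMod-modulus x = toℕ-injective (begin
    toℕ (addMod x (suc m))     ≡⟨ toℕ-addMod x (suc m) ⟩
    (toℕ x + suc m) % suc m    ≡⟨ [m+n]%n≡m%n (toℕ x) (suc m) ⟩
    toℕ x % suc m              ≡⟨ m<n⇒m%n≡m (toℕ<n x) ⟩
    toℕ x                      ∎)

  addMod-complement : (x y : Fin (suc m)) → addMod x (suc m ∸ toℕ x + toℕ y) ≡ y
  addMod-complement x y = toℕ-injective (begin
    toℕ (addMod x (suc m ∸ toℕ x + toℕ y))     ≡⟨ toℕ-addMod x _ ⟩
    (toℕ x + (suc m ∸ toℕ x + toℕ y)) % suc m  ≡⟨ cong (_% suc m) (+-assoc (toℕ x) _ (toℕ y)) ⟨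
    (toℕ x + (suc m ∸ toℕ x) + toℕ y) % suc m
      ≡⟨ cong (λ a → (a + toℕ y) % suc m) (m+[n∸m]≡n (<⇒≤ (toℕ<n x))) ⟩
    (suc m + toℕ y) % suc m                    ≡⟨ cong (_% suc m) (+-comm (suc m) (toℕ y)) ⟩
    (toℕ y + suc m) % suc m                    ≡⟨ [m+n]%n≡m%n (toℕ y) (suc m) ⟩
    toℕ y % suc m                              ≡⟨ m<n⇒m%n≡m (toℕ<n y) ⟩
    toℕ y                                      ∎)

  inc-injective : Injective _≡_ _≡_ (inc {suc m})
  inc-injective {x} {y} incx≡incy = begin
    x                   ≡⟨ addMod-inc-m x ⟨
    addMod (inc x) m    ≡⟨ cong (λ z → addMod z m) incx≡incy ⟩
    addMod (inc y) m    ≡⟨ addMod-inc-m y ⟩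
    y                   ∎
    where
    addMod-inc-m : ∀ z → addMod (inc z) m ≡ z
    addMod-inc-m z = trans (addMod-+ z 1 m) (addMod-modulus z)

  inc-closed⇒universal : {P : Fin (suc m) → Set} → (∀ y → P y → P (inc y)) →
                         ∀ x → P x → ∀ y → P y
  inc-closed⇒universal {P} P-inc x Px y = subst P (addMod-complement x y) (P-addMod _)
    where
    P-addMod : ∀ k → P (addMod x k)
    P-addMod zero    = subst P (sym (addMod-zero x)) Px
    P-addMod (suc k) = subst P (sym (addMod-suc x k)) (P-inc _ (P-addMod k))

next≗inc : ∀ {N} → next {suc N} ≗ inc
next≗inc {N} i = cong (_mod suc N) (+-comm 1 (toℕ i))

next-injective : ∀ {N} → Injective _≡_ _≡_ (next {N})
next-injective {suc N} {i} {j} nexti≡nextj =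
  inc-injective (trans (sym (next≗inc i)) (trans nexti≡nextj (next≗inc j)))

module _ {V : Set} {N : ℕ} where

  private
    module _ {c : Fin N → V} (c-surjective : Surjective _≡_ _≡_ c) where

      index : V → Fin N
      index = proj₁ ∘ surjective⇒strictlySurjective c-surjective

      c-index : ∀ v → c (index v) ≡ v
      c-index = proj₂ ∘ surjective⇒strictlySurjective c-surjective

  hamiltonian⇒successor : {E : V → V → Set} → HamiltonianCycle N E →
    Σ (V → V) λ σ → (∀ v → E v (σ v)) × IsSingleCycleOfLength N σ
  hamiltonian⇒successor {E} (c , (c-injective , c-surjective) , arc) =
    σ , σ-arc , (c , (c-injective , c-surjective) , σ-c)
    where
    σ : V → V
    σ = c ∘ next ∘ index c-surjective

    σ-arc : ∀ v → E v (σ v)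
    σ-arc v = subst (λ w → E w (σ v)) (c-index c-surjective v) (arc (index c-surjective v))

    σ-c : ∀ i → σ (c i) ≡ c (next i)
    σ-c i = cong (c ∘ next) (c-injective (c-index c-surjective (c i)))

  singleCycle⇒injective : {f : V → V} → IsSingleCycleOfLength N f → Injective _≡_ _≡_ f
  singleCycle⇒injective {f} (c , (c-injective , c-surjective) , f-c) {v} {w} fv≡fw = begin
    v          ≡⟨ c-index c-surjective v ⟨
    c (i v)    ≡⟨ cong c (next-injective (c-injective next-i)) ⟩
    c (i w)    ≡⟨ c-index c-surjective w ⟩
    w          ∎
    where
    i : V → Fin N
    i = index c-surjective

    next-i : c (next (i v)) ≡ c (next (i w))
    next-i = begin
      c (next (i v))  ≡⟨ f-c (i v) ⟨
      f (c (i v))     ≡⟨ cong f (c-index c-surjective v) ⟩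
      f v             ≡⟨ fv≡fw ⟩
      f w             ≡⟨ cong f (c-index c-surjective w) ⟨
      f (c (i w))     ≡⟨ f-c (i w) ⟩
      c (next (i w))  ∎

  singleCycle-resp-≗ : {f g : V → V} → f ≗ g →
                       IsSingleCycleOfLength N f → IsSingleCycleOfLength N g
  singleCycle-resp-≗ f≗g (c , c-bijective , f-c) =
    c , c-bijective , λ i → trans (sym (f≗g (c i))) (f-c i)

  singleCycle⇒hamiltonian : {E : V → V → Set} {f : V → V} → (∀ v → E v (f v)) →
                            IsSingleCycleOfLength N f → HamiltonianCycle N E
  singleCycle⇒hamiltonian {E} f-arc (c , c-bijective , f-c) =
    c , c-bijective , λ i → subst (E (c i)) (f-c i) (f-arc (c i))

fb-SBArc : ∀ {m n} (b : Word m (pred n) → Fin 2) (v : Word m n) → SBArc v (fb b v)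
fb-SBArc b [] = inj₁ refl
fb-SBArc {zero} b (() ∷ _)
fb-SBArc {suc m} b (x ∷ xs) with b xs
... | zero     = inj₁ (cong (xs ∷ʳ_) (addMod-zero x))
... | suc zero = inj₂ refl

module _ {m n : ℕ} {σ : Word (suc m) (suc n) → Word (suc m) (suc n)}
         (σ-injective : Injective _≡_ _≡_ σ) (σ-arc : ∀ v → SBArc v (σ v)) where

  private
    BumpsAt : Word (suc m) n → Fin (suc m) → Set
    BumpsAt xs x = σ (x ∷ xs) ≡ bump (x ∷ xs)

    bumpsAt-inc : ∀ xs x → BumpsAt xs x → BumpsAt xs (inc x)
    bumpsAt-inc xs x σx≡bump with σ-arc (inc x ∷ xs)
    ... | inj₂ σincx≡bump = σincx≡bump
    ... | inj₁ σincx≡save = trans σincx≡save (cong (λ z → xs ∷ʳ inc z) x≡incx)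
      where
      -- save (x⁺ xs) = bump (x xs) is already σ (x xs)
      x≡incx : x ≡ inc x
      x≡incx = ∷-injectiveˡ (σ-injective (trans σx≡bump (sym σincx≡save)))

    bumpsAt-all : ∀ xs x → BumpsAt xs x → ∀ y → BumpsAt xs y
    bumpsAt-all xs = inc-closed⇒universal (bumpsAt-inc xs)

    b : Word (suc m) n → Fin 2
    b xs with ≡-dec _≟ᶠ_ (σ (zero ∷ xs)) (bump (zero ∷ xs))
    ... | yes _ = suc zero
    ... | no _  = zero

    fb≗σ : fb b ≗ σ
    fb≗σ (x ∷ xs) with ≡-dec _≟ᶠ_ (σ (zero ∷ xs)) (bump (zero ∷ xs))
    ... | yes bumps₀ = sym (bumpsAt-all xs zero bumps₀ x)
    ... | no ¬bumps₀ with σ-arc (x ∷ xs)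
    ...   | inj₁ σx≡save = trans (cong (xs ∷ʳ_) (addMod-zero x)) (sym σx≡save)
    ...   | inj₂ σx≡bump = ⊥-elim (¬bumps₀ (bumpsAt-all xs x σx≡bump zero))

  injectiveSBSuccessor⇒fb : Σ (Word (suc m) n → Fin 2) λ b → fb b ≗ σ
  injectiveSBSuccessor⇒fb = b , fb≗σ

proposition2p1 : (m n : ℕ) → 1 ≤ m → 1 ≤ n →
    HamiltonianCycle (m ^ n) (SBArc {m} {n})
      ⇔ Σ (Word m (pred n) → Fin 2) (λ b → IsSingleCycleOfLength (m ^ n) (fb {m} {n} b))
proposition2p1 zero    n       () _
proposition2p1 (suc m) zero    _  ()
proposition2p1 (suc m) (suc n) _  _  = mk⇔ to from
  where
  N : ℕ
  N = suc m ^ suc n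

  to : HamiltonianCycle N (SBArc {suc m} {suc n}) →
       Σ (Word (suc m) n → Fin 2) (λ b → IsSingleCycleOfLength N (fb {suc m} {suc n} b))
  to hamiltonian =
    let σ , σ-arc , σ-cycle = hamiltonian⇒successor {E = SBArc} hamiltonian
        b , fb≗σ = injectiveSBSuccessor⇒fb (singleCycle⇒injective σ-cycle) σ-arc
    in  b , singleCycle-resp-≗ (sym ∘ fb≗σ) σ-cycle

  from : Σ (Word (suc m) n → Fin 2) (λ b → IsSingleCycleOfLength N (fb {suc m} {suc n} b)) →
         HamiltonianCycle N (SBArc {suc m} {suc n})
  from (b , fb-cycle) = singleCycle⇒hamiltonian {E = SBArc} (fb-SBArc b) fb-cycle
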